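{- Let $\mathcal V$ be a filter on $\omega$, let $\mathcal U$ be a $\mathcal V$-thick filter on $\oplus_{n\in\omega}n$, let $d\ge 3$ and let $P:\oplus_{n\in\omega}[n]^d\to 2$. Then there is $J\in\{0,1\}$ such that for every $A\in\mathcal U$ and every $k\in\omega$, the set $\{m\in\omega:\mu_{P,m,J}(A)\ge k\}$ belongs to $\mathcal V^+$.
   Context: For a family of sets $\{S_x\}_{x\in X}$, $\oplus_{x\in X}S_x=\bigcup_{x\in X}\{x\}\times S_x$; so $\oplus_{n\in\omega}n=\{(n,j):j<n\}$ and $\oplus_{n\in\omega}[n]^d=\{(n,s):s\in[n]^d\}$. For $A\subseteq\oplus_{n\in\omega}n$, $m\in\omega$, $j\in 2$: $\mathbf L_{P,m,j}(A)=\{H\subseteq m:\{m\}\times H\subseteq A\text{ and }P(m,s)=j\text{ for all }s\in[H]^d\}$ and $\mu_{P,m,j}(A)=\max\{|H|:H\in\mathbf L_{P,m,j}(A)\}$. $\mathcal V^+$ is the set of $Y\subseteq\omega$ meeting every member of $\mathcal V$. A filter $\mathcal U$ on $\oplus_{n\in\omega}n$ is $\mathcal V$-thick if for every $A\in\mathcal U$ and $k\in\omega$, $\{n\in\omega:k\le|\{j<n:(n,j)\in A\}|\}\in\mathcal V^+$. -}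

module Defs where

open import Level using (0ℓ)
open import Data.Nat using (ℕ; _≤_)
open import Data.Fin using (Fin)
open import Data.Fin.Subset using (Subset; _∈_; _⊆_; ∣_∣)
open import Data.Bool using (Bool)
open import Data.Product using (Σ; ∃; _×_; _,_; proj₁)
open import Data.Empty using (⊥)
open import Data.Unit using (⊤)
open import Relation.Nullary using (¬_)
open import Relation.Binary.PropositionalEquality using (_≡_)

PSet : Set → Set₁
PSet X = X → Set

record IsFilter {X : Set} (F : PSet X → Set) : Set₁ where
  field
    full   : F (λ _ → ⊤)
    proper : ¬ F (λ _ → ⊥)
    upward : ∀ (A B : PSet X) → F A → (∀ x → A x → B x) → F B
    inter  : ∀ (A B : PSet X) → F A → F B → F (λ x → A x × B x)

⊕n : Set
⊕n = Σ ℕ Fin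

[_]^_ : ℕ → ℕ → Set
[ n ]^ d = Σ (Subset n) (λ s → ∣ s ∣ ≡ d)

⊕[n]^ : ℕ → Set
⊕[n]^ d = Σ ℕ (λ n → [ n ]^ d)

_⁺ : (PSet ℕ → Set) → PSet ℕ → Set₁
(𝒱 ⁺) Y = ∀ (B : PSet ℕ) → 𝒱 B → ∃ λ n → B n × Y n

-- "k ≤ |{ j < n : (n , j) ∈ A }|" : some subset of that set has at least k elements
k≤|A_n| : ℕ → PSet ⊕n → ℕ → Set
k≤|A_n| k A n = ∃ λ (H : Subset n) → (∀ j → j ∈ H → A (n , j)) × k ≤ ∣ H ∣

Thick : (PSet ℕ → Set) → (PSet ⊕n → Set) → Set₁
Thick 𝒱 𝒰 = ∀ (A : PSet ⊕n) → 𝒰 A → ∀ (k : ℕ) → (𝒱 ⁺) (k≤|A_n| k A)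

L : ∀ {d} → (⊕[n]^ d → Bool) → (m : ℕ) → Bool → PSet ⊕n → Subset m → Set
L {d} P m j A H =
  (∀ i → i ∈ H → A (m , i)) ×
  (∀ (s : [ m ]^ d) → proj₁ s ⊆ H → P (m , s) ≡ j)

-- μ_{P,m,j}(A) ≥ k  (μ is the maximum of |H| over H ∈ 𝐋_{P,m,j}(A);
-- this maximum exists since ∅ ∈ 𝐋 and there are finitely many H ⊆ m)
μ≥ : ∀ {d} → (⊕[n]^ d → Bool) → (m : ℕ) → Bool → PSet ⊕n → ℕ → Set
μ≥ P m j A k = ∃ λ (H : Subset m) → L P m j A H × k ≤ ∣ H ∣

-- Colour every d-subset s of m by P (m , s).  If the colour false fails, some A₀ ∈ 𝒰,
-- k₀ and B₀ ∈ 𝒱 witness this: no m ∈ B₀ carries a false-homogeneous k₀-set inside A₀.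
-- Given A₁ ∈ 𝒰, k₁ and B₁ ∈ 𝒱, thickness applied to A₀ ∩ A₁ yields m ∈ B₀ ∩ B₁ whose
-- fibre of A₀ ∩ A₁ has at least R_d(k₀, k₁) points, and the finite Ramsey theorem finds
-- in it a false-homogeneous k₀-set (impossible) or a true-homogeneous k₁-set.
module Submission where

open import Defs
open import Level using (Level)
open import Axiom.ExcludedMiddle using (ExcludedMiddle)
open import Data.Nat using (ℕ; zero; suc; _+_; _≤_; _<_; _≟_; pred; z≤n; s≤s)
open import Data.Nat.Properties using (≤-trans; ≤-pred; m≤m+n; m≤n+m; 1+n≢0; ≡-irrelevant)
open import Data.Bool using (Bool; true; false)
open import Data.Fin using (Fin; zero; suc)
open import Data.Fin.Subset
open import Data.Fin.Subset.Properties
  using (_∈?_; nonempty?; Empty-unique; ∣⊥∣≡0; p⊆q⇒∣p∣≤∣q∣; p⊂q⇒∣p∣<∣q∣; ⊆-refl; ⊆-trans; ⊆-min;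
         p─⊥≡p; p─q⊆p; ∪-identityʳ; p⊆p∪q; x∈p∪q⁺; x∈p∪q⁻; x∈⁅x⁆; x∈⁅y⁆⇒x≡y)
open import Data.Vec using (_∷_; here; there)
open import Data.Product using (Σ; ∃; _×_; _,_; proj₁; proj₂)
open import Data.Sum using (_⊎_; inj₁; inj₂; [_,_])
import Data.Sum as Sum
open import Function using (_∘_)
open import Relation.Nullary.Decidable using (decidable-stable)
open import Relation.Nullary using (¬_; yes; no; contradiction)
open import Relation.Binary.PropositionalEquality using (_≡_; sym; trans; cong; subst)

private
  variable
    m : ℕ

x∈p⇒suc∣p-x∣≡∣p∣ : ∀ (p : Subset m) {x} → x ∈ p → suc ∣ p - x ∣ ≡ ∣ p ∣
x∈p⇒suc∣p-x∣≡∣p∣ (true ∷ p)  here        = cong (suc ∘ ∣_∣) (p─⊥≡p p)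
x∈p⇒suc∣p-x∣≡∣p∣ (true ∷ p)  (there x∈p) = cong suc (x∈p⇒suc∣p-x∣≡∣p∣ p x∈p)
x∈p⇒suc∣p-x∣≡∣p∣ (false ∷ p) (there x∈p) = x∈p⇒suc∣p-x∣≡∣p∣ p x∈p

x∈p⇒p≡p-x∪⁅x⁆ : ∀ (p : Subset m) {x} → x ∈ p → p ≡ (p - x) ∪ ⁅ x ⁆
x∈p⇒p≡p-x∪⁅x⁆ (true ∷ p)  here        = cong (true ∷_) (sym (trans (∪-identityʳ (p ─ ⊥)) (p─⊥≡p p)))
x∈p⇒p≡p-x∪⁅x⁆ (true ∷ p)  (there x∈p) = cong (true ∷_) (x∈p⇒p≡p-x∪⁅x⁆ p x∈p)
x∈p⇒p≡p-x∪⁅x⁆ (false ∷ p) (there x∈p) = cong (false ∷_) (x∈p⇒p≡p-x∪⁅x⁆ p x∈p)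

x∉p-x : ∀ (p : Subset m) x → x ∉ p - x
x∉p-x (_ ∷ p) zero    ()
x∉p-x (_ ∷ p) (suc x) (there x∈p-x) = x∉p-x p x x∈p-x

x∉p⇒∣p∣<∣p∪⁅x⁆∣ : ∀ {p : Subset m} {x} → x ∉ p → ∣ p ∣ < ∣ p ∪ ⁅ x ⁆ ∣
x∉p⇒∣p∣<∣p∪⁅x⁆∣ {x = x} x∉p =
  p⊂q⇒∣p∣<∣q∣ (p⊆p∪q ⁅ x ⁆ , x , x∈p∪q⁺ (inj₂ (x∈⁅x⁆ x)) , x∉p)

p⊆q∪⁅x⁆∧x∉p⇒p⊆q : ∀ {p q : Subset m} {x} → p ⊆ q ∪ ⁅ x ⁆ → x ∉ p → p ⊆ q
p⊆q∪⁅x⁆∧x∉p⇒p⊆q {q = q} {x} p⊆q∪x x∉p {y} y∈p with x∈p∪q⁻ q ⁅ x ⁆ (p⊆q∪x y∈p)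
... | inj₁ y∈q = y∈q
... | inj₂ y∈x = contradiction (subst (_∈ _) (x∈⁅y⁆⇒x≡y x y∈x) y∈p) x∉p

p∪⁅x⁆⊆q : ∀ {p q : Subset m} {x} → p ⊆ q → x ∈ q → p ∪ ⁅ x ⁆ ⊆ q
p∪⁅x⁆⊆q {p = p} {x = x} p⊆q x∈q y∈p∪x with x∈p∪q⁻ p ⁅ x ⁆ y∈p∪x
... | inj₁ y∈p = p⊆q y∈p
... | inj₂ y∈x = subst (_∈ _) (sym (x∈⁅y⁆⇒x≡y x y∈x)) x∈q

0<∣p∣⇒Nonempty : ∀ (p : Subset m) → 0 < ∣ p ∣ → Nonempty p
0<∣p∣⇒Nonempty {m} p 0<∣p∣ with nonempty? p
... | yes ne = ne
... | no ¬ne with () ← subst (0 <_) (trans (cong ∣_∣ (Empty-unique ¬ne)) (∣⊥∣≡0 m)) 0<∣p∣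

∣p∣≡0⇒p≡⊥ : ∀ (p : Subset m) → ∣ p ∣ ≡ 0 → p ≡ ⊥
∣p∣≡0⇒p≡⊥ p ∣p∣≡0 = Empty-unique λ (x , x∈p) → 1+n≢0 (trans (x∈p⇒suc∣p-x∣≡∣p∣ p x∈p) ∣p∣≡0)

Homogeneous : (Subset m → Bool) → ℕ → Bool → Subset m → Set
Homogeneous c d j T = ∀ s → s ⊆ T → ∣ s ∣ ≡ d → c s ≡ j

HomogeneousIn : (Subset m → Bool) → ℕ → Bool → ℕ → Subset m → Set
HomogeneousIn c d j k H = ∃ λ T → T ⊆ H × k ≤ ∣ T ∣ × Homogeneous c d j T

link : (Subset m → Bool) → Fin m → Subset m → Bool
link c x t = c (t ∪ ⁅ x ⁆)

homogeneous-⊆ : ∀ {c : Subset m → Bool} {d j S T} → S ⊆ T → Homogeneous c d j T → Homogeneous c d j S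
homogeneous-⊆ S⊆T homT s s⊆S = homT s (⊆-trans s⊆S S⊆T)

homogeneous-0 : ∀ {c : Subset m → Bool} {j} T → c ⊥ ≡ j → Homogeneous c 0 j T
homogeneous-0 {c = c} _ c⊥≡j s _ ∣s∣≡0 = trans (cong c (∣p∣≡0⇒p≡⊥ s ∣s∣≡0)) c⊥≡j

homogeneous-⊥ : ∀ (c : Subset m → Bool) d j → Homogeneous c (suc d) j ⊥
homogeneous-⊥ {m} c d j s s⊆⊥ ∣s∣≡1+d
  with () ← subst (suc d ≤_) (∣⊥∣≡0 m) (subst (_≤ ∣ ⊥ {m} ∣) ∣s∣≡1+d (p⊆q⇒∣p∣≤∣q∣ s⊆⊥))

homogeneousIn-⊆ : ∀ {c : Subset m → Bool} {d j k S T} → S ⊆ T → HomogeneousIn c d j k S → HomogeneousIn c d j k T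
homogeneousIn-⊆ S⊆T (U , U⊆S , k≤U , homU) = U , ⊆-trans U⊆S S⊆T , k≤U , homU

homogeneous-adjoin : ∀ {c : Subset m → Bool} {d j T} x → Homogeneous c (suc d) j T
  → Homogeneous (link c x) d j T → Homogeneous c (suc d) j (T ∪ ⁅ x ⁆)
homogeneous-adjoin {c = c} x homT homL s s⊆T∪x ∣s∣≡1+d with x ∈? s
... | no x∉s  = homT s (p⊆q∪⁅x⁆∧x∉p⇒p⊆q s⊆T∪x x∉s) ∣s∣≡1+d
... | yes x∈s = trans (cong c (x∈p⇒p≡p-x∪⁅x⁆ s x∈s))
  (homL (s - x) (p⊆q∪⁅x⁆∧x∉p⇒p⊆q (⊆-trans (p─q⊆p s ⁅ x ⁆) s⊆T∪x) (x∉p-x s x))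
        (cong pred (trans (x∈p⇒suc∣p-x∣≡∣p∣ s x∈s) ∣s∣≡1+d)))

homogeneousIn-adjoin : ∀ {c : Subset m → Bool} {d j k H T x} → x ∈ H → T ⊆ H - x
  → Homogeneous (link c x) d j T → HomogeneousIn c (suc d) j k T → HomogeneousIn c (suc d) j (suc k) H
homogeneousIn-adjoin {H = H} {x = x} x∈H T⊆H-x homL (U , U⊆T , k≤U , homU) =
  U ∪ ⁅ x ⁆ , p∪⁅x⁆⊆q (⊆-trans U⊆H-x (p─q⊆p H ⁅ x ⁆)) x∈H ,
  ≤-trans (s≤s k≤U) (x∉p⇒∣p∣<∣p∪⁅x⁆∣ (λ x∈U → x∉p-x H x (U⊆H-x x∈U))) ,
  homogeneous-adjoin x homU (homogeneous-⊆ U⊆T homL)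
  where U⊆H-x = ⊆-trans U⊆T T⊆H-x

-- The Erdős–Rado recursion: a point x of H is removed, dimension d is applied to the
-- link of x, and inside the homogeneous set found one recurses on a or on b.
ramseyNumber : ℕ → ℕ → ℕ → ℕ
ramseyNumber zero    a       b       = a + b
ramseyNumber (suc d) zero    b       = 0
ramseyNumber (suc d) (suc a) zero    = 0
ramseyNumber (suc d) (suc a) (suc b) =
  suc (ramseyNumber d (ramseyNumber (suc d) a (suc b)) (ramseyNumber (suc d) (suc a) b))

Ramsey : ℕ → ℕ → ℕ → Set
Ramsey d a b = ∀ {m} (c : Subset m → Bool) {H} → ramseyNumber d a b ≤ ∣ H ∣
  → HomogeneousIn c d false a H ⊎ HomogeneousIn c d true b H

ramsey-step : ∀ {d a b} → Ramsey d (ramseyNumber (suc d) a (suc b)) (ramseyNumber (suc d) (suc a) b)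
  → Ramsey (suc d) a (suc b) → Ramsey (suc d) (suc a) b → Ramsey (suc d) (suc a) (suc b)
ramsey-step ramsey-link ramsey-a ramsey-b c {H} R≤∣H∣
  with x , x∈H ← 0<∣p∣⇒Nonempty H (≤-trans (s≤s z≤n) R≤∣H∣)
  with ramsey-link (link c x) (≤-pred (subst (_ ≤_) (sym (x∈p⇒suc∣p-x∣≡∣p∣ H x∈H)) R≤∣H∣))
... | inj₁ (T , T⊆H-x , R≤∣T∣ , homL) =
  Sum.map (homogeneousIn-adjoin x∈H T⊆H-x homL) (homogeneousIn-⊆ (⊆-trans T⊆H-x (p─q⊆p H ⁅ x ⁆)))
          (ramsey-a c R≤∣T∣)
... | inj₂ (T , T⊆H-x , R≤∣T∣ , homL) =
  Sum.map (homogeneousIn-⊆ (⊆-trans T⊆H-x (p─q⊆p H ⁅ x ⁆))) (homogeneousIn-adjoin x∈H T⊆H-x homL)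
          (ramsey-b c R≤∣T∣)

ramsey : ∀ d a b → Ramsey d a b
ramsey zero a b c {H} a+b≤∣H∣ with c ⊥ in c⊥≡j
... | false = inj₁ (H , ⊆-refl , ≤-trans (m≤m+n a b) a+b≤∣H∣ , homogeneous-0 H c⊥≡j)
... | true  = inj₂ (H , ⊆-refl , ≤-trans (m≤n+m b a) a+b≤∣H∣ , homogeneous-0 H c⊥≡j)
ramsey (suc d) zero    b       c {H} _ = inj₁ (⊥ , ⊆-min H , z≤n , homogeneous-⊥ c d false)
ramsey (suc d) (suc a) zero    c {H} _ = inj₂ (⊥ , ⊆-min H , z≤n , homogeneous-⊥ c d true)
ramsey (suc d) (suc a) (suc b) =
  ramsey-step (ramsey d _ _) (ramsey (suc d) a (suc b)) (ramsey (suc d) (suc a) b)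

-- Subsets of the wrong size get an arbitrary colour: homogeneity only inspects d-subsets.
colouring : ∀ {d} → (⊕[n]^ d → Bool) → (n : ℕ) → Subset n → Bool
colouring {d} P n s with ∣ s ∣ ≟ d
... | yes ∣s∣≡d = P (n , s , ∣s∣≡d)
... | no _      = false

colouring-[]^ : ∀ {d} (P : ⊕[n]^ d → Bool) n (s : [ n ]^ d) → colouring P n (proj₁ s) ≡ P (n , s)
colouring-[]^ {d} P n (s , ∣s∣≡d) with ∣ s ∣ ≟ d
... | yes ∣s∣≡d′ = cong (λ e → P (n , s , e)) (≡-irrelevant ∣s∣≡d′ ∣s∣≡d)
... | no ∣s∣≢d   = contradiction ∣s∣≡d ∣s∣≢d

homogeneousIn⇒μ≥ : ∀ {d} (P : ⊕[n]^ d → Bool) {n j k A} {H : Subset n} → (∀ i → i ∈ H → A (n , i))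
  → HomogeneousIn (colouring P n) d j k H → μ≥ P n j A k
homogeneousIn⇒μ≥ P {n} H⊆A (T , T⊆H , k≤∣T∣ , homT) =
  T , ((λ i i∈T → H⊆A i (T⊆H i∈T)) ,
       λ s s⊆T → trans (sym (colouring-[]^ P n s)) (homT (proj₁ s) s⊆T (proj₂ s))) ,
  k≤∣T∣

μ≥-dichotomy : ∀ {d} (P : ⊕[n]^ d → Bool) {A₀ A₁ : PSet ⊕n} k₀ k₁ {n}
  → k≤|A_n| (ramseyNumber d k₀ k₁) (λ x → A₀ x × A₁ x) n
  → μ≥ P n false A₀ k₀ ⊎ μ≥ P n true A₁ k₁
μ≥-dichotomy {d} P {A₀} {A₁} k₀ k₁ {n} (H , H⊆A₀∩A₁ , R≤∣H∣) =
  Sum.map (homogeneousIn⇒μ≥ P {A = A₀} (λ i → proj₁ ∘ H⊆A₀∩A₁ i))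
          (homogeneousIn⇒μ≥ P {A = A₁} (λ i → proj₂ ∘ H⊆A₀∩A₁ i))
          (ramsey d k₀ k₁ (colouring P n) R≤∣H∣)

μ≥-dichotomy-positive : ∀ {𝒱 𝒰} → IsFilter 𝒰 → Thick 𝒱 𝒰 → ∀ {d} (P : ⊕[n]^ d → Bool) {A₀ A₁}
  → 𝒰 A₀ → 𝒰 A₁ → ∀ k₀ k₁ → (𝒱 ⁺) (λ n → μ≥ P n false A₀ k₀ ⊎ μ≥ P n true A₁ k₁)
μ≥-dichotomy-positive 𝒰-filter thick {d} P {A₀} {A₁} A₀∈𝒰 A₁∈𝒰 k₀ k₁ B B∈𝒱
  with n , n∈B , big ← thick _ (IsFilter.inter 𝒰-filter A₀ A₁ A₀∈𝒰 A₁∈𝒰) (ramseyNumber d k₀ k₁) B B∈𝒱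
  = n , n∈B , μ≥-dichotomy P {A₀} {A₁} k₀ k₁ big

⁺-dichotomy : ∀ {a b} (em : ∀ {ℓ : Level} → ExcludedMiddle ℓ) {𝒱 : PSet ℕ → Set} → IsFilter 𝒱
  → {I₀ : Set a} {I₁ : Set b} (Y₀ : I₀ → PSet ℕ) (Y₁ : I₁ → PSet ℕ)
  → (∀ i j → (𝒱 ⁺) (λ n → Y₀ i n ⊎ Y₁ j n))
  → (∀ i → (𝒱 ⁺) (Y₀ i)) ⊎ (∀ j → (𝒱 ⁺) (Y₁ j))
⁺-dichotomy em {𝒱} 𝒱-filter Y₀ Y₁ union⁺ with em
... | yes Y₀⁺ = inj₁ Y₀⁺
... | no ¬Y₀⁺ = inj₂ λ j B₁ B₁∈𝒱 → decidable-stable em (¬Y₀⁺ ∘ Y₀⁺-unless-hit j B₁∈𝒱)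
  where
  Y₀⁺-unless-hit : ∀ j {B₁} → 𝒱 B₁ → ¬ (∃ λ n → B₁ n × Y₁ j n) → ∀ i → (𝒱 ⁺) (Y₀ i)
  Y₀⁺-unless-hit j {B₁} B₁∈𝒱 miss i B₀ B₀∈𝒱
    with union⁺ i j _ (IsFilter.inter 𝒱-filter B₀ B₁ B₀∈𝒱 B₁∈𝒱)
  ... | n , (n∈B₀ , _)    , inj₁ y₀ = n , n∈B₀ , y₀
  ... | n , (_    , n∈B₁) , inj₂ y₁ = contradiction (n , n∈B₁ , y₁) miss

lemma3p18 : (em : ∀ {ℓ : Level} → ExcludedMiddle ℓ)
    → (𝒱 : PSet ℕ → Set) → IsFilter 𝒱
    → (𝒰 : PSet ⊕n → Set) → IsFilter 𝒰 → Thick 𝒱 𝒰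
    → (d : ℕ) → 3 ≤ d → (P : ⊕[n]^ d → Bool)
    → Σ Bool (λ J → ∀ (A : PSet ⊕n) → 𝒰 A → ∀ (k : ℕ)
        → (𝒱 ⁺) (λ m → μ≥ P m J A k))
lemma3p18 em 𝒱 𝒱-filter 𝒰 𝒰-filter thick d _ P =
  [ (λ all-false → false , λ A A∈𝒰 k → all-false (A , A∈𝒰 , k))
  , (λ all-true  → true  , λ A A∈𝒰 k → all-true  (A , A∈𝒰 , k)) ]
  (⁺-dichotomy em 𝒱-filter (large false) (large true)
    λ (A₀ , A₀∈𝒰 , k₀) (A₁ , A₁∈𝒰 , k₁) → μ≥-dichotomy-positive 𝒰-filter thick P A₀∈𝒰 A₁∈𝒰 k₀ k₁)
  where
  large : Bool → Σ (PSet ⊕n) (λ A → 𝒰 A × ℕ) → PSet ℕ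
  large J (A , _ , k) m = μ≥ P m J A k
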